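{- Let $n$ be an integer with $n\ge 3$. Then the complement $\overline{C_n}$ of the cycle $C_n$ of length $n$ is not an open XOR-magic graph.
   Context: For a vertex $x$, $N(x)$ is its set of neighbours. A simple connected graph $G=(V,E)$ is an open XOR-magic graph if $|V|=2^p$ for some positive integer $p$ and there is a bijection $\ell:V\to(\mathbb{Z}_2)^p$ such that $\sum_{y\in N(x)}\ell(y)$ is the zero vector of $(\mathbb{Z}_2)^p$ for every $x\in V$. -}

module Defs where

open import Data.Nat using (ℕ; zero; suc; _^_; _≤_; _%_; _≡ᵇ_)
open import Data.Fin using (Fin; toℕ; _≟_)
open import Data.Bool using (Bool; true; false; _xor_; _∨_; not; _∧_; if_then_else_)
open import Data.Vec using (Vec; replicate; zipWith)
open import Data.Product using (Σ; _×_; ∃-syntax)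
open import Relation.Binary.PropositionalEquality using (_≡_)
open import Relation.Nullary.Decidable using (⌊_⌋)
open import Function.Bundles using (_⤖_; Bijection)

Graph : ℕ → Set
Graph m = Fin m → Fin m → Bool

IsSimple : ∀ {m} → Graph m → Set
IsSimple {m} G = ((x : Fin m) → G x x ≡ false) × ((x y : Fin m) → G x y ≡ G y x)

data Walk {m} (G : Graph m) : Fin m → Fin m → Set where
  here : ∀ {x} → Walk G x x
  step : ∀ {x y z} → G x y ≡ true → Walk G y z → Walk G x z

Connected : ∀ {m} → Graph m → Set
Connected {m} G = (x y : Fin m) → Walk G x y

Z2^ : ℕ → Set
Z2^ p = Vec Bool p

zeroV : ∀ {p} → Z2^ p
zeroV = replicate _ false

_⊕_ : ∀ {p} → Z2^ p → Z2^ p → Z2^ p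
_⊕_ = zipWith _xor_

sumFin : ∀ {m p} → (Fin m → Z2^ p) → Z2^ p
sumFin {zero}  f = zeroV
sumFin {suc m} f = f Fin.zero ⊕ sumFin (λ i → f (Fin.suc i))

nbrSum : ∀ {m p} → Graph m → (Fin m → Z2^ p) → Fin m → Z2^ p
nbrSum G ℓ x = sumFin (λ y → if G x y then ℓ y else zeroV)

OpenXORMagic : ∀ {m} → Graph m → Set
OpenXORMagic {m} G =
  IsSimple G × Connected G ×
  Σ ℕ λ p → (1 ≤ p) × (m ≡ 2 ^ p) ×
    Σ (Fin m ⤖ Z2^ p) λ ℓ →
      (x : Fin m) → nbrSum G (Bijection.to ℓ) x ≡ zeroV

cycleAdj : (n : ℕ) → Graph n
cycleAdj zero    ()
cycleAdj (suc k) i j =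
  (toℕ j ≡ᵇ (suc (toℕ i) % suc k)) ∨ (toℕ i ≡ᵇ (suc (toℕ j) % suc k))

complement : ∀ {m} → Graph m → Graph m
complement G x y = not ⌊ x ≟ y ⌋ ∧ not (G x y)

-- In the complement of C_n (n ≥ 4) the neighbourhoods of the vertices 1 and 2
-- are V ∖ {0,1,2} and V ∖ {1,2,3}; they differ exactly in {0,3}. Adding the
-- two zero neighbourhood sums over (ℤ₂)^p leaves ℓ(0) + ℓ(3) = 0, i.e.
-- ℓ(0) = ℓ(3), contradicting injectivity. For n = 3 the order is not a power of 2.
module Submission where

open import Defs
open import Data.Nat using (ℕ; zero; suc; _+_; _^_; _%_; _≡ᵇ_; _≤_; s≤s; z≤n)
import Data.Nat.Properties as ℕ
open import Data.Nat.DivMod using (n%n≡0; m<n⇒m%n≡m)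
open import Data.Fin using (Fin; toℕ; _≟_; #_)
open import Data.Fin.Properties using (toℕ<n)
open import Data.Bool using (Bool; true; false; not; _xor_; _∨_; if_then_else_)
open import Data.Bool.Properties using (xor-same; xor-identityʳ; xor-∧-commutativeRing)
open import Data.Vec using ([]; _∷_; head; tail)
open import Data.Product using (_,_)
open import Data.Sum using (inj₁; inj₂)
open import Algebra.Bundles using (CommutativeRing)
open import Algebra.Properties.CommutativeSemigroup
  (CommutativeRing.+-commutativeSemigroup xor-∧-commutativeRing) using (interchange)
open import Function.Bundles using (Bijection)
open import Relation.Binary.PropositionalEquality
  using (_≡_; _≢_; refl; sym; trans; subst; cong; cong₂; module ≡-Reasoning)
open import Relation.Nullary using (¬_; does)
open import Relation.Nullary.Decidable using (dec-false)

private
  variable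
    m p : ℕ

⊕-identityˡ : (x : Z2^ p) → zeroV ⊕ x ≡ x
⊕-identityˡ []      = refl
⊕-identityˡ (a ∷ x) = cong (a ∷_) (⊕-identityˡ x)

⊕-identityʳ : (x : Z2^ p) → x ⊕ zeroV ≡ x
⊕-identityʳ []      = refl
⊕-identityʳ (a ∷ x) = cong₂ _∷_ (xor-identityʳ a) (⊕-identityʳ x)

⊕-self : (x : Z2^ p) → x ⊕ x ≡ zeroV
⊕-self []      = refl
⊕-self (a ∷ x) = cong₂ _∷_ (xor-same a) (⊕-self x)

⊕-interchange : (w x y z : Z2^ p) → (w ⊕ x) ⊕ (y ⊕ z) ≡ (w ⊕ y) ⊕ (x ⊕ z)
⊕-interchange []      []      []      []      = refl
⊕-interchange (a ∷ w) (b ∷ x) (c ∷ y) (d ∷ z) =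
  cong₂ _∷_ (interchange a b c d) (⊕-interchange w x y z)

xor≡false⇒≡ : (a b : Bool) → a xor b ≡ false → a ≡ b
xor≡false⇒≡ false false _ = refl
xor≡false⇒≡ true  true  _ = refl
xor≡false⇒≡ false true  ()
xor≡false⇒≡ true  false ()

⊕≡zeroV⇒≡ : (x y : Z2^ p) → x ⊕ y ≡ zeroV → x ≡ y
⊕≡zeroV⇒≡ []      []      _  = refl
⊕≡zeroV⇒≡ (a ∷ x) (b ∷ y) eq =
  cong₂ _∷_ (xor≡false⇒≡ a b (cong head eq)) (⊕≡zeroV⇒≡ x y (cong tail eq))

infixr 25 _·_

_·_ : Bool → Z2^ p → Z2^ p
b · x = if b then x else zeroV

·-distribʳ-xor : (a b : Bool) (x : Z2^ p) → (a xor b) · x ≡ a · x ⊕ b · x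
·-distribʳ-xor false false x = sym (⊕-self zeroV)
·-distribʳ-xor false true  x = sym (⊕-identityˡ x)
·-distribʳ-xor true  false x = sym (⊕-identityʳ x)
·-distribʳ-xor true  true  x = sym (⊕-self x)

sumFin-cong : {f g : Fin m → Z2^ p} → (∀ i → f i ≡ g i) → sumFin f ≡ sumFin g
sumFin-cong {m = zero}  f≡g = refl
sumFin-cong {m = suc m} f≡g = cong₂ _⊕_ (f≡g Fin.zero) (sumFin-cong (λ i → f≡g (Fin.suc i)))

sumFin-zeroV : sumFin {m} {p} (λ _ → zeroV) ≡ zeroV
sumFin-zeroV {m = zero}  = refl
sumFin-zeroV {m = suc m} = trans (⊕-identityˡ _) (sumFin-zeroV {m})

sumFin-⊕ : (f g : Fin m → Z2^ p) → sumFin f ⊕ sumFin g ≡ sumFin (λ i → f i ⊕ g i)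
sumFin-⊕ {m = zero}  f g = ⊕-self zeroV
sumFin-⊕ {m = suc m} f g = begin
  (f Fin.zero ⊕ sumFin (f ∘suc)) ⊕ (g Fin.zero ⊕ sumFin (g ∘suc))
    ≡⟨ ⊕-interchange (f Fin.zero) _ (g Fin.zero) _ ⟩
  (f Fin.zero ⊕ g Fin.zero) ⊕ (sumFin (f ∘suc) ⊕ sumFin (g ∘suc))
    ≡⟨ cong ((f Fin.zero ⊕ g Fin.zero) ⊕_) (sumFin-⊕ (f ∘suc) (g ∘suc)) ⟩
  (f Fin.zero ⊕ g Fin.zero) ⊕ sumFin (λ i → f (Fin.suc i) ⊕ g (Fin.suc i))
    ∎
  where
  open ≡-Reasoning
  _∘suc : (Fin (suc m) → Z2^ p) → Fin m → Z2^ p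
  (h ∘suc) i = h (Fin.suc i)

-- `does` rather than ⌊_⌋, which would not reduce ⌊ suc i ≟ suc u ⌋ to ⌊ i ≟ u ⌋.
sumFin-indicator : (u : Fin m) (f : Fin m → Z2^ p) → sumFin (λ z → does (z ≟ u) · f z) ≡ f u
sumFin-indicator {m = suc m} Fin.zero    f =
  trans (cong (f Fin.zero ⊕_) (sumFin-zeroV {m})) (⊕-identityʳ _)
sumFin-indicator {m = suc m} (Fin.suc u) f =
  trans (⊕-identityˡ _) (sumFin-indicator u (λ i → f (Fin.suc i)))

sumFin-pair : (u v : Fin m) (f : Fin m → Z2^ p) →
  sumFin (λ z → (does (z ≟ u) xor does (z ≟ v)) · f z) ≡ f u ⊕ f v
sumFin-pair u v f = begin
  sumFin (λ z → (does (z ≟ u) xor does (z ≟ v)) · f z)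
    ≡⟨ sumFin-cong (λ z → ·-distribʳ-xor (does (z ≟ u)) (does (z ≟ v)) (f z)) ⟩
  sumFin (λ z → does (z ≟ u) · f z ⊕ does (z ≟ v) · f z)
    ≡⟨ sumFin-⊕ (λ z → does (z ≟ u) · f z) (λ z → does (z ≟ v) · f z) ⟨
  sumFin (λ z → does (z ≟ u) · f z) ⊕ sumFin (λ z → does (z ≟ v) · f z)
    ≡⟨ cong₂ _⊕_ (sumFin-indicator u f) (sumFin-indicator v f) ⟩
  f u ⊕ f v
    ∎
  where open ≡-Reasoning

nbrSum-⊕ : (G : Graph m) (ℓ : Fin m → Z2^ p) (x y : Fin m) →
  nbrSum G ℓ x ⊕ nbrSum G ℓ y ≡ sumFin (λ z → (G x z xor G y z) · ℓ z)
nbrSum-⊕ G ℓ x y =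
  trans (sumFin-⊕ (λ z → G x z · ℓ z) (λ z → G y z · ℓ z))
        (sym (sumFin-cong (λ z → ·-distribʳ-xor (G x z) (G y z) (ℓ z))))

NeighbourhoodsDifferOnlyAt : Graph m → (x y u v : Fin m) → Set
NeighbourhoodsDifferOnlyAt G x y u v = ∀ z → (G x z xor G y z) ≡ (does (z ≟ u) xor does (z ≟ v))

zero-nbrSums⇒equal-labels : (G : Graph m) (ℓ : Fin m → Z2^ p) {x y u v : Fin m} →
  NeighbourhoodsDifferOnlyAt G x y u v →
  nbrSum G ℓ x ≡ zeroV → nbrSum G ℓ y ≡ zeroV → ℓ u ≡ ℓ v
zero-nbrSums⇒equal-labels G ℓ {x} {y} {u} {v} differ sumˣ sumʸ = ⊕≡zeroV⇒≡ (ℓ u) (ℓ v) (begin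
  ℓ u ⊕ ℓ v                                              ≡⟨ sumFin-pair u v ℓ ⟨
  sumFin (λ z → (does (z ≟ u) xor does (z ≟ v)) · ℓ z)   ≡⟨ sumFin-cong (λ z → cong (_· ℓ z) (differ z)) ⟨
  sumFin (λ z → (G x z xor G y z) · ℓ z)                 ≡⟨ nbrSum-⊕ G ℓ x y ⟨
  nbrSum G ℓ x ⊕ nbrSum G ℓ y                            ≡⟨ cong₂ _⊕_ sumˣ sumʸ ⟩
  zeroV ⊕ zeroV                                          ≡⟨ ⊕-self zeroV ⟩
  zeroV                                                  ∎)
  where open ≡-Reasoning

differOnlyAt⇒¬OpenXORMagic : {G : Graph m} {x y u v : Fin m} →
  NeighbourhoodsDifferOnlyAt G x y u v → u ≢ v → ¬ OpenXORMagic G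
differOnlyAt⇒¬OpenXORMagic {G = G} {x} {y} differ u≢v (_ , _ , _ , _ , _ , ℓ , sums) =
  u≢v (Bijection.injective ℓ
        (zero-nbrSums⇒equal-labels G (Bijection.to ℓ) differ (sums x) (sums y)))

≢⇒≡ᵇ-false : {a b : ℕ} → a ≢ b → (a ≡ᵇ b) ≡ false
≢⇒≡ᵇ-false {a} {b} = dec-false (a ℕ.≟ b)

cycleAdj-nonAdjacent : (i j : Fin (suc m)) → 1 ≤ toℕ i → 2 + toℕ i ≤ toℕ j →
  cycleAdj (suc m) i j ≡ false
cycleAdj-nonAdjacent {m} i j 1≤a a+2≤b =
  cong₂ _∨_ (≢⇒≡ᵇ-false b≢[1+a]%[1+m]) (≢⇒≡ᵇ-false a≢[1+b]%[1+m])
  where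
  a b : ℕ
  a = toℕ i
  b = toℕ j

  b≤m : b ≤ m
  b≤m = ℕ.≤-pred (toℕ<n j)

  b≢[1+a]%[1+m] : b ≢ suc a % suc m
  b≢[1+a]%[1+m] = subst (b ≢_) (sym (m<n⇒m%n≡m (ℕ.m<n⇒m<1+n (ℕ.<-≤-trans a+2≤b b≤m))))
                        (ℕ.>⇒≢ a+2≤b)

  a≢[1+b]%[1+m] : a ≢ suc b % suc m
  a≢[1+b]%[1+m] with ℕ.m≤n⇒m<n∨m≡n (s≤s b≤m)
  ... | inj₁ 1+b<1+m = subst (a ≢_) (sym (m<n⇒m%n≡m 1+b<1+m))
                             (ℕ.<⇒≢ (s≤s (ℕ.≤-trans (ℕ.m≤n+m a 2) a+2≤b)))
  ... | inj₂ 1+b≡1+m = subst (a ≢_) (sym (trans (cong (_% suc m) 1+b≡1+m) (n%n≡0 (suc m))))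
                             (ℕ.>⇒≢ 1≤a)

complement-cycle-1-2-differOnlyAt-0-3 : (k : ℕ) →
  NeighbourhoodsDifferOnlyAt (complement (cycleAdj (4 + k))) (# 1) (# 2) (# 0) (# 3)
complement-cycle-1-2-differOnlyAt-0-3 k Fin.zero                         = refl
complement-cycle-1-2-differOnlyAt-0-3 k (Fin.suc Fin.zero)               = refl
complement-cycle-1-2-differOnlyAt-0-3 k (Fin.suc (Fin.suc Fin.zero))     = refl
complement-cycle-1-2-differOnlyAt-0-3 k (Fin.suc (Fin.suc (Fin.suc Fin.zero))) =
  cong (λ c → not c xor false) (cycleAdj-nonAdjacent {m = 3 + k} (# 1) (# 3) (s≤s z≤n) ℕ.≤-refl)
complement-cycle-1-2-differOnlyAt-0-3 k z@(Fin.suc (Fin.suc (Fin.suc (Fin.suc _)))) =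
  cong₂ (λ c d → not c xor not d)
        (cycleAdj-nonAdjacent {m = 3 + k} (# 1) z (s≤s z≤n) (s≤s (s≤s (s≤s z≤n))))
        (cycleAdj-nonAdjacent {m = 3 + k} (# 2) z (s≤s z≤n) (s≤s (s≤s (s≤s (s≤s z≤n)))))

corollary2 : (n : ℕ) → 3 ≤ n → ¬ OpenXORMagic (complement (cycleAdj n))
corollary2 1 (s≤s ())
corollary2 2 (s≤s (s≤s ()))
corollary2 3 _ (_ , _ , suc q , _ , 3≡2^[1+q] , _) = ℕ.even≢odd (2 ^ q) 1 (sym 3≡2^[1+q])
corollary2 (suc (suc (suc (suc k)))) _ =
  differOnlyAt⇒¬OpenXORMagic {x = # 1} {# 2} {# 0} {# 3}
    (complement-cycle-1-2-differOnlyAt-0-3 k) λ ()
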